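{- Let $d\ge3$, $\mathcal A=\{0,\dots,d-1\}$, $\varphi$ the morphism $\varphi(i)=0(i+1)$ ($0\le i\le d-2$), $\varphi(d-1)=0(d-1)(d-1)$, $\mathbf u$ its fixed point, and $F_0=\varepsilon$, $F_k=\varphi(F_{k-1})0$ for $k=1,\dots,d-1$. Let $k\in\{0,1,\dots,d-1\}$. Then: 1. $F_k=\varphi^{k-1}(0)\varphi^{k-2}(0)\cdots\varphi(0)0$ for $k=1,\dots,d-1$; 2. only letters strictly smaller than $k$ occur in $F_k$; 3. $F_kk=\varphi^k(0)$; 4. $\varphi(F_k)0=\varphi^k(0)F_k$; 5. $\varphi^d(0)=\varphi^{d-1}(0)\varphi^{d-1}(0)(d-1)$; 6. $F_k(d-1)$ is a suffix of $F_{d-1}(d-1)=\varphi^{d-1}(0)$; 7. $\varphi^k(d-1)F_k(d-1)\in\mathcal L(\mathbf u)$; 8. $\varphi^k(d-1)=F_k(d-1)(d-1)\varphi(d-1)\varphi^2(d-1)\cdots\varphi^{k-1}(d-1)$ for $k=1,\dots,d-1$; 9. if a letter $i\ne d-1$ occurs in $\varphi^k(d-1)$, then $i<k$.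
   Context: $\mathbf u$ is the unique infinite word starting with $0$ with $\varphi(\mathbf u)=\mathbf u$; $\mathcal L(\mathbf u)$ is its set of finite factors; $\varphi^0$ is the identity. -}

module Defs where

open import Data.Nat using (ℕ; zero; suc; _+_; _<_; _<?_; s≤s)
open import Data.Fin using (Fin; zero; suc; toℕ; fromℕ; fromℕ<)
open import Data.List using (List; []; _∷_; _++_; concatMap; length; lookup)
open import Data.Product using (∃)
open import Relation.Binary.PropositionalEquality using (_≡_)
open import Relation.Nullary using (yes; no)

-- Throughout, the alphabet is A = {0,…,d-1} = Fin d with d = suc n.
-- The letter d-1 is  fromℕ n , the letter 0 is  zero.

Word : ℕ → Set
Word n = List (Fin (suc n))

φ-letter : (n : ℕ) → Fin (suc n) → Word n
φ-letter n i with toℕ i <? n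
... | yes p = zero ∷ fromℕ< (s≤s p) ∷ []
... | no _  = zero ∷ fromℕ n ∷ fromℕ n ∷ []

φ : (n : ℕ) → Word n → Word n
φ n = concatMap (φ-letter n)

φ^ : (n : ℕ) → ℕ → Word n → Word n
φ^ n zero    w = w
φ^ n (suc j) w = φ n (φ^ n j w)

F : (n : ℕ) → ℕ → Word n
F n zero    = []
F n (suc k) = φ n (F n k) ++ (zero ∷ [])

InfWord : ℕ → Set
InfWord n = ℕ → Fin (suc n)

IsPrefix : {n : ℕ} → Word n → InfWord n → Set
IsPrefix w u = (j : Fin (length w)) → lookup w j ≡ u (toℕ j)

take∞ : {n : ℕ} → ℕ → InfWord n → Word n
take∞ zero    u = []
take∞ (suc m) u = u zero ∷ take∞ m (λ i → u (suc i))

-- φ(u) = u : the image under φ of every finite prefix of u is a prefix of u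
-- (φ is non-erasing, so this says exactly that the infinite word φ(u) equals u).
IsFixedPoint : {n : ℕ} → InfWord n → Set
IsFixedPoint {n} u = (m : ℕ) → IsPrefix (φ n (take∞ m u)) u

_∈L_ : {n : ℕ} → Word n → InfWord n → Set
w ∈L u = ∃ λ i → (j : Fin (length w)) → lookup w j ≡ u (i + toℕ j)

-- The factor in item 7 occurs in φ^k(φ^d(0)), since φ^d(0) ends
-- with (d-1)(d-1) and φ^k(d-1) begins with F_k (d-1).
module Submission where

open import Defs
open import Data.Nat using (ℕ; zero; suc; _≤_; _<_; _<?_; _+_; _≤′_; ≤′-refl; ≤′-step; z≤n; s<s)
open import Data.Nat.Properties using (<-irrefl; m<n⇒m<1+n; ≤⇒≤′; ≤-pred; suc-injective)
open import Data.Fin using (Fin; zero; suc; toℕ; fromℕ; inject₁)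
open import Data.Fin.Properties using (toℕ-fromℕ; toℕ-fromℕ<; toℕ-inject₁; toℕ<n; toℕ-injective; fromℕ≢inject₁)
open import Data.Fin.Relation.Unary.Top using (view; ‵fromℕ; ‵inject₁)
open import Data.List using (List; []; _∷_; [_]; _++_; concat; map; upTo; reverse; length; applyUpTo)
open import Data.List.Properties using (++-assoc; ++-identityʳ; concatMap-++; reverse-++; upTo-∷ʳ; map-upTo; map-applyUpTo)
open import Data.List.Membership.Propositional using (_∈_)
open import Data.List.Relation.Unary.All as All using (All; []; _∷_)
open import Data.List.Relation.Unary.All.Properties using (++⁺; map⁺; concat⁺)
open import Data.Product using (_×_; ∃; _,_)
open import Data.Empty using (⊥-elim)
open import Relation.Nullary using (yes; no; contradiction)
open import Function using (_∘_)
open import Relation.Binary.PropositionalEquality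
  using (_≡_; _≢_; refl; sym; trans; cong; cong₂; subst; module ≡-Reasoning)
open ≡-Reasoning

module _ {n : ℕ} where

  IsPrefix-++ˡ : ∀ (xs ys : Word n) {u} → IsPrefix (xs ++ ys) u → IsPrefix xs u
  IsPrefix-++ˡ (x ∷ xs) ys     pre zero    = pre zero
  IsPrefix-++ˡ (x ∷ xs) ys {u} pre (suc j) = IsPrefix-++ˡ xs ys {u ∘ suc} (pre ∘ suc) j

  IsPrefix-++⇒∈L : ∀ (p w s : Word n) {u} → IsPrefix (p ++ w ++ s) u → w ∈L u
  IsPrefix-++⇒∈L []      w s {u} pre = 0 , IsPrefix-++ˡ w s {u} pre
  IsPrefix-++⇒∈L (x ∷ p) w s {u} pre with IsPrefix-++⇒∈L p w s {u ∘ suc} (pre ∘ suc)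
  ... | i , occ = suc i , occ

  take∞-IsPrefix : ∀ (w : Word n) {u} → IsPrefix w u → take∞ (length w) u ≡ w
  take∞-IsPrefix []       pre = refl
  take∞-IsPrefix (x ∷ xs) {u} pre = cong₂ _∷_ (sym (pre zero)) (take∞-IsPrefix xs {u ∘ suc} (pre ∘ suc))

module _ (n : ℕ) where

  private
    N : Fin (suc n)
    N = fromℕ n

  φ-[_] : ∀ x → φ n [ x ] ≡ φ-letter n x
  φ-[ x ] = ++-identityʳ (φ-letter n x)

  φ-++ : ∀ (xs ys : Word n) → φ n (xs ++ ys) ≡ φ n xs ++ φ n ys
  φ-++ = concatMap-++ (φ-letter n)

  φ-concat : ∀ (ws : List (Word n)) → φ n (concat ws) ≡ concat (map (φ n) ws)
  φ-concat []       = refl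
  φ-concat (w ∷ ws) = trans (φ-++ w (concat ws)) (cong (φ n w ++_) (φ-concat ws))

  φ^-++ : ∀ j (xs ys : Word n) → φ^ n j (xs ++ ys) ≡ φ^ n j xs ++ φ^ n j ys
  φ^-++ zero    xs ys = refl
  φ^-++ (suc j) xs ys = trans (cong (φ n) (φ^-++ j xs ys)) (φ-++ (φ^ n j xs) (φ^ n j ys))

  φ^-+ : ∀ a b (w : Word n) → φ^ n (a + b) w ≡ φ^ n a (φ^ n b w)
  φ^-+ zero    b w = refl
  φ^-+ (suc a) b w = cong (φ n) (φ^-+ a b w)

  φ-letter-fromℕ : φ-letter n N ≡ zero ∷ N ∷ N ∷ []
  φ-letter-fromℕ with toℕ N <? n
  ... | yes N<n = ⊥-elim (<-irrefl (toℕ-fromℕ n) N<n)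
  ... | no _    = refl

  φ-letter-inject₁ : ∀ (j : Fin n) → φ-letter n (inject₁ j) ≡ zero ∷ suc j ∷ []
  φ-letter-inject₁ j with toℕ (inject₁ j) <? n
  ... | yes j<n = cong (λ i → zero ∷ suc i ∷ []) (toℕ-injective (trans (toℕ-fromℕ< j<n) (toℕ-inject₁ j)))
  ... | no j≮n  = contradiction (subst (_< n) (sym (toℕ-inject₁ j)) (toℕ<n j)) j≮n

  φ-All : ∀ {P Q : Fin (suc n) → Set} → (∀ {x} → P x → All Q (φ-letter n x)) →
          ∀ {w} → All P w → All Q (φ n w)
  φ-All f ps = concat⁺ (map⁺ (All.map f ps))

  φ-letter-< : ∀ {k} x → toℕ x < k → All (λ y → toℕ y < suc k) (φ-letter n x)
  φ-letter-< x x<k with view x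
  ... | ‵fromℕ     rewrite φ-letter-fromℕ =
    s<s z≤n ∷ m<n⇒m<1+n x<k ∷ m<n⇒m<1+n x<k ∷ []
  ... | ‵inject₁ j rewrite φ-letter-inject₁ j =
    s<s z≤n ∷ s<s (subst (_< _) (toℕ-inject₁ j) x<k) ∷ []

  φ-letter-<-except-fromℕ : ∀ {k} x → (x ≢ N → toℕ x < k) →
                            All (λ y → y ≢ N → toℕ y < suc k) (φ-letter n x)
  φ-letter-<-except-fromℕ x x<k with view x
  ... | ‵fromℕ     rewrite φ-letter-fromℕ =
    (λ _ → s<s z≤n) ∷ (λ N≢N → ⊥-elim (N≢N refl)) ∷ (λ N≢N → ⊥-elim (N≢N refl)) ∷ []
  ... | ‵inject₁ j rewrite φ-letter-inject₁ j =
    (λ _ → s<s z≤n) ∷ (λ _ → s<s (subst (_< _) (toℕ-inject₁ j) (x<k (fromℕ≢inject₁ ∘ sym)))) ∷ []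

  F-<-letters : ∀ k → All (λ y → toℕ y < k) (F n k)
  F-<-letters zero    = []
  F-<-letters (suc k) = ++⁺ (φ-All (φ-letter-< _) (F-<-letters k)) (s<s z≤n ∷ [])

  φ^-fromℕ-<-letters : ∀ k → All (λ y → y ≢ N → toℕ y < k) (φ^ n k [ N ])
  φ^-fromℕ-<-letters zero    = (λ N≢N → ⊥-elim (N≢N refl)) ∷ []
  φ^-fromℕ-<-letters (suc k) = φ-All (φ-letter-<-except-fromℕ _) (φ^-fromℕ-<-letters k)

  F-∷ʳ : ∀ m (i : Fin (suc n)) → toℕ i ≡ m → F n m ++ [ i ] ≡ φ^ n m [ zero ]
  F-∷ʳ zero    zero    _ = refl
  F-∷ʳ (suc m) (suc j) i≡m = begin
    (φ n (F n m) ++ [ zero ]) ++ [ suc j ]  ≡⟨ ++-assoc (φ n (F n m)) [ zero ] [ suc j ] ⟩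
    φ n (F n m) ++ zero ∷ suc j ∷ []        ≡⟨ cong (φ n (F n m) ++_) (sym (trans φ-[ inject₁ j ] (φ-letter-inject₁ j))) ⟩
    φ n (F n m) ++ φ n [ inject₁ j ]        ≡⟨ sym (φ-++ (F n m) [ inject₁ j ]) ⟩
    φ n (F n m ++ [ inject₁ j ])            ≡⟨ cong (φ n) (F-∷ʳ m (inject₁ j) (trans (toℕ-inject₁ j) (suc-injective i≡m))) ⟩
    φ n (φ^ n m [ zero ])                   ∎

  F-∷ʳ-fromℕ : F n n ++ [ N ] ≡ φ^ n n [ zero ]
  F-∷ʳ-fromℕ = F-∷ʳ n N (toℕ-fromℕ n)

  F-suc : ∀ m → F n (suc m) ≡ φ^ n m [ zero ] ++ F n m
  F-suc zero    = refl
  F-suc (suc m) = begin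
    φ n (F n (suc m)) ++ [ zero ]                     ≡⟨ cong (λ w → φ n w ++ [ zero ]) (F-suc m) ⟩
    φ n (φ^ n m [ zero ] ++ F n m) ++ [ zero ]        ≡⟨ cong (_++ [ zero ]) (φ-++ (φ^ n m [ zero ]) (F n m)) ⟩
    (φ^ n (suc m) [ zero ] ++ φ n (F n m)) ++ [ zero ] ≡⟨ ++-assoc (φ^ n (suc m) [ zero ]) (φ n (F n m)) [ zero ] ⟩
    φ^ n (suc m) [ zero ] ++ F n (suc m)              ∎

  F≡concat : ∀ m → F n m ≡ concat (map (λ j → φ^ n j [ zero ]) (reverse (upTo m)))
  F≡concat zero    = refl
  F≡concat (suc m) = begin
    F n (suc m)                                ≡⟨ F-suc m ⟩
    g m ++ F n m                               ≡⟨ cong (g m ++_) (F≡concat m) ⟩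
    concat (map g (m ∷ reverse (upTo m)))      ≡⟨ cong (concat ∘ map g) (reverse-++ (upTo m) [ m ]) ⟨
    concat (map g (reverse (upTo m ++ [ m ]))) ≡⟨ cong (concat ∘ map g ∘ reverse) (upTo-∷ʳ m) ⟩
    concat (map g (reverse (upTo (suc m))))    ∎
    where
    g : ℕ → Word n
    g j = φ^ n j [ zero ]

  F-suffix : ∀ {m k} → m ≤′ k → ∃ λ p → p ++ F n m ≡ F n k
  F-suffix ≤′-refl = [] , refl
  F-suffix {m} (≤′-step {k} m≤k) with F-suffix m≤k
  ... | p , p++Fm≡Fk = φ^ n k [ zero ] ++ p , (begin
    (φ^ n k [ zero ] ++ p) ++ F n m ≡⟨ ++-assoc (φ^ n k [ zero ]) p (F n m) ⟩
    φ^ n k [ zero ] ++ p ++ F n m   ≡⟨ cong (φ^ n k [ zero ] ++_) p++Fm≡Fk ⟩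
    φ^ n k [ zero ] ++ F n k        ≡⟨ F-suc k ⟨
    F n (suc k)                     ∎)

  F-∷ʳ-fromℕ-suffix : ∀ {m} → m ≤ n → ∃ λ p → p ++ (F n m ++ [ N ]) ≡ F n n ++ [ N ]
  F-∷ʳ-fromℕ-suffix {m} m≤n with F-suffix (≤⇒≤′ m≤n)
  ... | p , p++Fm≡Fn = p , trans (sym (++-assoc p (F n m) [ N ])) (cong (_++ [ N ]) p++Fm≡Fn)

  φ^-suc-n-[0]-∷ʳ-NN : φ^ n (suc n) [ zero ] ≡ (φ^ n n [ zero ] ++ F n n) ++ N ∷ N ∷ []
  φ^-suc-n-[0]-∷ʳ-NN = begin
    φ n (φ^ n n [ zero ])                   ≡⟨ cong (φ n) F-∷ʳ-fromℕ ⟨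
    φ n (F n n ++ [ N ])                    ≡⟨ φ-++ (F n n) [ N ] ⟩
    φ n (F n n) ++ φ n [ N ]                ≡⟨ cong (φ n (F n n) ++_) (trans φ-[ N ] φ-letter-fromℕ) ⟩
    φ n (F n n) ++ zero ∷ N ∷ N ∷ []        ≡⟨ ++-assoc (φ n (F n n)) [ zero ] (N ∷ N ∷ []) ⟨
    F n (suc n) ++ N ∷ N ∷ []               ≡⟨ cong (_++ N ∷ N ∷ []) (F-suc n) ⟩
    (φ^ n n [ zero ] ++ F n n) ++ N ∷ N ∷ [] ∎

  φ^-suc-n-[0] : φ^ n (suc n) [ zero ] ≡ φ^ n n [ zero ] ++ φ^ n n [ zero ] ++ [ N ]
  φ^-suc-n-[0] = begin
    φ^ n (suc n) [ zero ]                    ≡⟨ φ^-suc-n-[0]-∷ʳ-NN ⟩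
    (P ++ F n n) ++ N ∷ N ∷ []               ≡⟨ ++-assoc P (F n n) (N ∷ N ∷ []) ⟩
    P ++ F n n ++ [ N ] ++ [ N ]             ≡⟨ cong (P ++_) (++-assoc (F n n) [ N ] [ N ]) ⟨
    P ++ (F n n ++ [ N ]) ++ [ N ]           ≡⟨ cong (λ w → P ++ w ++ [ N ]) F-∷ʳ-fromℕ ⟩
    P ++ P ++ [ N ]                          ∎
    where
    P : Word n
    P = φ^ n n [ zero ]

  φ^-fromℕ : ∀ m → φ^ n m [ N ] ≡ F n m ++ [ N ] ++ concat (applyUpTo (λ j → φ^ n j [ N ]) m)
  φ^-fromℕ zero    = refl
  φ^-fromℕ (suc m) = begin
    φ n (φ^ n m [ N ])                         ≡⟨ cong (φ n) (φ^-fromℕ m) ⟩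
    φ n (F n m ++ N ∷ C)                       ≡⟨ φ-++ (F n m) (N ∷ C) ⟩
    φ n (F n m) ++ φ-letter n N ++ φ n C       ≡⟨ cong (λ w → φ n (F n m) ++ w ++ φ n C) φ-letter-fromℕ ⟩
    φ n (F n m) ++ zero ∷ N ∷ N ∷ φ n C        ≡⟨ ++-assoc (φ n (F n m)) [ zero ] (N ∷ N ∷ φ n C) ⟨
    F n (suc m) ++ N ∷ N ∷ φ n C               ≡⟨ cong (λ w → F n (suc m) ++ N ∷ N ∷ w) φC ⟩
    F n (suc m) ++ [ N ] ++ concat (applyUpTo h (suc m)) ∎
    where
    h : ℕ → Word n
    h j = φ^ n j [ N ]
    C : Word n
    C = concat (applyUpTo h m)
    φC : φ n C ≡ concat (applyUpTo (h ∘ suc) m)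
    φC = trans (φ-concat (applyUpTo h m)) (cong concat (map-applyUpTo h (φ n) m))

  φ^-fromℕ-upTo : ∀ m → φ^ n m [ N ] ≡ F n m ++ [ N ] ++ concat (map (λ j → φ^ n j [ N ]) (upTo m))
  φ^-fromℕ-upTo m = trans (φ^-fromℕ m) (cong (λ ws → F n m ++ [ N ] ++ concat ws) (sym (map-upTo _ m)))

  module _ (u : InfWord n) (u0≡0 : u 0 ≡ zero) (fixed : IsFixedPoint u) where

    φ^-[0]-IsPrefix : ∀ j → IsPrefix (φ^ n j [ zero ]) u
    φ^-[0]-IsPrefix zero zero = sym u0≡0
    φ^-[0]-IsPrefix (suc j)   =
      subst (λ w → IsPrefix (φ n w) u) (take∞-IsPrefix w (φ^-[0]-IsPrefix j)) (fixed (length w))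
      where
      w : Word n
      w = φ^ n j [ zero ]

    φ^-fromℕ-F-fromℕ-∈L : ∀ k → (φ^ n k [ N ] ++ F n k ++ [ N ]) ∈L u
    φ^-fromℕ-F-fromℕ-∈L k = IsPrefix-++⇒∈L (φ^ n k A) (X ++ F n k ++ [ N ]) C {u}
      (subst (λ w → IsPrefix w u) split (φ^-[0]-IsPrefix (k + suc n)))
      where
      A X C : Word n
      A = φ^ n n [ zero ] ++ F n n
      X = φ^ n k [ N ]
      C = concat (applyUpTo (λ j → φ^ n j [ N ]) k)
      split : φ^ n (k + suc n) [ zero ] ≡ φ^ n k A ++ (X ++ F n k ++ [ N ]) ++ C
      split = begin
        φ^ n (k + suc n) [ zero ]               ≡⟨ φ^-+ k (suc n) [ zero ] ⟩
        φ^ n k (φ^ n (suc n) [ zero ])          ≡⟨ cong (φ^ n k) φ^-suc-n-[0]-∷ʳ-NN ⟩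
        φ^ n k (A ++ [ N ] ++ [ N ])            ≡⟨ φ^-++ k A ([ N ] ++ [ N ]) ⟩
        φ^ n k A ++ φ^ n k ([ N ] ++ [ N ])     ≡⟨ cong (φ^ n k A ++_) (φ^-++ k [ N ] [ N ]) ⟩
        φ^ n k A ++ X ++ X                      ≡⟨ cong (λ w → φ^ n k A ++ X ++ w) (φ^-fromℕ k) ⟩
        φ^ n k A ++ X ++ F n k ++ [ N ] ++ C    ≡⟨ cong (λ w → φ^ n k A ++ X ++ w) (++-assoc (F n k) [ N ] C) ⟨
        φ^ n k A ++ X ++ (F n k ++ [ N ]) ++ C  ≡⟨ cong (φ^ n k A ++_) (++-assoc X (F n k ++ [ N ]) C) ⟨
        φ^ n k A ++ (X ++ F n k ++ [ N ]) ++ C  ∎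

lemma17 : (n : ℕ) → 2 ≤ n →
    (u : InfWord n) → u 0 ≡ zero → IsFixedPoint u →
    (k : Fin (suc n)) →
      ((1 ≤ toℕ k) → F n (toℕ k) ≡ concat (map (λ j → φ^ n j (zero ∷ [])) (reverse (upTo (toℕ k)))))
    × ((i : Fin (suc n)) → i ∈ F n (toℕ k) → toℕ i < toℕ k)
    × (F n (toℕ k) ++ (k ∷ []) ≡ φ^ n (toℕ k) (zero ∷ []))
    × (φ n (F n (toℕ k)) ++ (zero ∷ []) ≡ φ^ n (toℕ k) (zero ∷ []) ++ F n (toℕ k))
    × (φ^ n (suc n) (zero ∷ []) ≡ φ^ n n (zero ∷ []) ++ φ^ n n (zero ∷ []) ++ (fromℕ n ∷ []))
    × ((∃ λ p → p ++ (F n (toℕ k) ++ (fromℕ n ∷ [])) ≡ F n n ++ (fromℕ n ∷ []))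
       × (F n n ++ (fromℕ n ∷ []) ≡ φ^ n n (zero ∷ [])))
    × ((φ^ n (toℕ k) (fromℕ n ∷ []) ++ F n (toℕ k) ++ (fromℕ n ∷ [])) ∈L u)
    × ((1 ≤ toℕ k) → φ^ n (toℕ k) (fromℕ n ∷ [])
         ≡ F n (toℕ k) ++ (fromℕ n ∷ []) ++ concat (map (λ j → φ^ n j (fromℕ n ∷ [])) (upTo (toℕ k))))
    × ((i : Fin (suc n)) → i ∈ φ^ n (toℕ k) (fromℕ n ∷ []) → i ≢ fromℕ n → toℕ i < toℕ k)
lemma17 n _ u u0≡0 fixed k =
    (λ _ → F≡concat n m)
  , (λ i → All.lookup (F-<-letters n m))
  , F-∷ʳ n m k refl
  , F-suc n m
  , φ^-suc-n-[0] n
  , (F-∷ʳ-fromℕ-suffix n (≤-pred (toℕ<n k)) , F-∷ʳ-fromℕ n)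
  , φ^-fromℕ-F-fromℕ-∈L n u u0≡0 fixed m
  , (λ _ → φ^-fromℕ-upTo n m)
  , (λ i → All.lookup (φ^-fromℕ-<-letters n m))
  where
  m : ℕ
  m = toℕ k
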